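{- Let $a$ be an integer with $|a|\ge 3$ and let $b=-1$. Let $(u_n)_{n\ge 0}$ be defined by $u_0=0$, $u_1=1$ and $u_{n+1}=au_n+bu_{n-1}$ for $n\ge 1$. Then $|u_n|$ is composite for all $n\ge 3$.
   Context: A nonnegative integer $m$ is called composite if $m\neq 0,1$ and $m$ is not a prime number. -}

module Defs where

open import Data.Nat using (ℕ; zero; suc)
open import Data.Integer using (ℤ; _+_; _*_; -_; 0ℤ; 1ℤ)

u : ℤ → ℤ → ℕ → ℤ
u a b zero = 0ℤ
u a b (suc zero) = 1ℤ
u a b (suc (suc n)) = a * u a b (suc n) + b * u a b n

-- With b = -1 the addition formula u (m+n+1) = u (m+1) u (n+1) - u m u n factors
-- u (2k) = u k (u (k+1) - u (k-1)) and u (2k+1) = (u (k+1) + u k) (u (k+1) - u k).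
-- Since |a| ≥ 3, the recurrence gives |u (n+1)| > 2 |u n|, so |u| is positive from
-- index 1 on and increases by at least 2 per step after that; hence for n ≥ 3 both
-- factors have absolute value at least 2.
module Submission where

open import Defs
open import Data.Nat using (ℕ; _≤_)
open import Data.Integer using (ℤ; ∣_∣; -[1+_])
open import Data.Nat.Primality using (Composite)

open import Data.Nat as ℕ using (zero; suc; _<_; z≤n; s≤s; 2+)
import Data.Nat.Properties as ℕ
open import Data.Nat.Divisibility using (m∣m*n)
open import Data.Nat.Primality using (composite)
open import Data.Integer as ℤ using (_+_; _*_; _-_; -_; -1ℤ; 0ℤ; 1ℤ)
import Data.Integer.Properties as ℤ
open import Data.Integer.Tactic.RingSolver using (solve-∀)
import Data.Nat.Tactic.RingSolver as ℕ-Solver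
open import Data.Product using (∃-syntax; _,_)
open import Data.Sum using (_⊎_; inj₁; inj₂)
open import Relation.Nullary using (contradiction)
open import Relation.Binary.PropositionalEquality using (_≡_; refl; sym; trans; cong; cong₂; subst; module ≡-Reasoning)

composite-* : ∀ {m n} → 1 < m → 1 < n → Composite (m ℕ.* n)
composite-* {m@(2+ _)} {n} _ 1<n = composite (ℕ.m<m*n m n 1<n) (m∣m*n n)
composite-* {1} (s≤s ()) _

even-or-odd : ∀ n → ∃[ k ] (n ≡ k ℕ.+ k ⊎ n ≡ suc (k ℕ.+ k))
even-or-odd zero = 0 , inj₁ refl
even-or-odd (suc n) with even-or-odd n
... | k , inj₁ refl = k , inj₂ refl
... | k , inj₂ refl = suc k , inj₁ (cong suc (sym (ℕ.+-suc k k)))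

∣i∣≤∣i+j∣+∣j∣ : ∀ i j → ∣ i ∣ ≤ ∣ i + j ∣ ℕ.+ ∣ j ∣
∣i∣≤∣i+j∣+∣j∣ i j = subst (λ x → ∣ x ∣ ≤ ∣ i + j ∣ ℕ.+ ∣ j ∣) (i+j-j≡i i j) (ℤ.∣i-j∣≤∣i∣+∣j∣ (i + j) j)
  where
  i+j-j≡i : ∀ i j → (i + j) - j ≡ i
  i+j-j≡i = solve-∀

∣j∣+2≤∣i∣⇒2≤∣i+j∣ : ∀ i j → ∣ j ∣ ℕ.+ 2 ≤ ∣ i ∣ → 2 ≤ ∣ i + j ∣
∣j∣+2≤∣i∣⇒2≤∣i+j∣ i j ∣j∣+2≤∣i∣ = ℕ.+-cancelˡ-≤ (∣ j ∣) 2 (∣ i + j ∣) (begin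
  ∣ j ∣ ℕ.+ 2           ≤⟨ ∣j∣+2≤∣i∣ ⟩
  ∣ i ∣                 ≤⟨ ∣i∣≤∣i+j∣+∣j∣ i j ⟩
  ∣ i + j ∣ ℕ.+ ∣ j ∣   ≡⟨ ℕ.+-comm (∣ i + j ∣) (∣ j ∣) ⟩
  ∣ j ∣ ℕ.+ ∣ i + j ∣   ∎)
  where open ℕ.≤-Reasoning

∣j∣+2≤∣i∣⇒2≤∣i-j∣ : ∀ i j → ∣ j ∣ ℕ.+ 2 ≤ ∣ i ∣ → 2 ≤ ∣ i - j ∣
∣j∣+2≤∣i∣⇒2≤∣i-j∣ i j ∣j∣+2≤∣i∣ =
  ∣j∣+2≤∣i∣⇒2≤∣i+j∣ i (- j) (subst (λ x → x ℕ.+ 2 ≤ ∣ i ∣) (sym (ℤ.∣-i∣≡∣i∣ j)) ∣j∣+2≤∣i∣)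

u[1+m+n]≡u[1+m]*u[1+n]+b*u[m]*u[n] :
  ∀ a b m n → u a b (suc (m ℕ.+ n)) ≡ u a b (suc m) * u a b (suc n) + b * (u a b m * u a b n)
u[1+m+n]≡u[1+m]*u[1+n]+b*u[m]*u[n] a b zero n = by-ring b (u a b (suc n)) (u a b n)
  where
  by-ring : ∀ b x y → x ≡ 1ℤ * x + b * (0ℤ * y)
  by-ring = solve-∀
u[1+m+n]≡u[1+m]*u[1+n]+b*u[m]*u[n] a b (suc zero) n = by-ring a b (u a b (suc n)) (u a b n)
  where
  by-ring : ∀ a b x y → a * x + b * y ≡ (a * 1ℤ + b * 0ℤ) * x + b * (1ℤ * y)
  by-ring = solve-∀
u[1+m+n]≡u[1+m]*u[1+n]+b*u[m]*u[n] a b (2+ m) n = begin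
  a * u a b (suc (suc m ℕ.+ n)) + b * u a b (suc (m ℕ.+ n))
    ≡⟨ cong₂ (λ x y → a * x + b * y) (u[1+m+n]≡u[1+m]*u[1+n]+b*u[m]*u[n] a b (suc m) n)
                                      (u[1+m+n]≡u[1+m]*u[1+n]+b*u[m]*u[n] a b m n) ⟩
  a * (u a b (2+ m) * P + b * (u a b (suc m) * Q)) + b * (u a b (suc m) * P + b * (u a b m * Q))
    ≡⟨ by-ring a b (u a b (suc m)) (u a b m) P Q ⟩
  u a b (suc (2+ m)) * P + b * (u a b (2+ m) * Q)
    ∎
  where
  open ≡-Reasoning
  P Q : ℤ
  P = u a b (suc n)
  Q = u a b n
  by-ring : ∀ a b y z P Q → a * ((a * y + b * z) * P + b * (y * Q)) + b * (y * P + b * (z * Q))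
                          ≡ (a * (a * y + b * z) + b * y) * P + b * ((a * y + b * z) * Q)
  by-ring = solve-∀

module _ (a : ℤ) where
  private
    U : ℕ → ℤ
    U = u a -1ℤ
    V : ℕ → ℕ
    V n = ∣ U n ∣

  u[2+2k]≡u[1+k]*[u[2+k]-u[k]] : ∀ k → U (suc (k ℕ.+ suc k)) ≡ U (suc k) * (U (2+ k) - U k)
  u[2+2k]≡u[1+k]*[u[2+k]-u[k]] k =
    trans (u[1+m+n]≡u[1+m]*u[1+n]+b*u[m]*u[n] a -1ℤ k (suc k)) (by-ring (U k) (U (suc k)) (U (2+ k)))
    where
    by-ring : ∀ x y z → y * z + -1ℤ * (x * y) ≡ y * (z - x)
    by-ring = solve-∀

  u[1+2k]≡[u[1+k]+u[k]]*[u[1+k]-u[k]] : ∀ k → U (suc (k ℕ.+ k)) ≡ (U (suc k) + U k) * (U (suc k) - U k)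
  u[1+2k]≡[u[1+k]+u[k]]*[u[1+k]-u[k]] k =
    trans (u[1+m+n]≡u[1+m]*u[1+n]+b*u[m]*u[n] a -1ℤ k k) (by-ring (U k) (U (suc k)))
    where
    by-ring : ∀ x y → y * y + -1ℤ * (x * x) ≡ (y + x) * (y - x)
    by-ring = solve-∀

  ∣a∣*∣u[1+n]∣≤∣u[2+n]∣+∣u[n]∣ : ∀ n → ∣ a ∣ ℕ.* V (suc n) ≤ V (2+ n) ℕ.+ V n
  ∣a∣*∣u[1+n]∣≤∣u[2+n]∣+∣u[n]∣ n = begin
    ∣ a ∣ ℕ.* V (suc n)      ≡⟨ ℤ.∣i*j∣≡∣i∣*∣j∣ a (U (suc n)) ⟨
    ∣ a * U (suc n) ∣        ≡⟨ cong ∣_∣ (by-ring a (U (suc n)) (U n)) ⟩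
    ∣ U (2+ n) + U n ∣       ≤⟨ ℤ.∣i+j∣≤∣i∣+∣j∣ (U (2+ n)) (U n) ⟩
    V (2+ n) ℕ.+ V n         ∎
    where
    open ℕ.≤-Reasoning
    by-ring : ∀ a x y → a * x ≡ (a * x + -1ℤ * y) + y
    by-ring = solve-∀

  module _ (3≤∣a∣ : 3 ≤ ∣ a ∣) where

    ∣u∣-doubles-step : ∀ n → V n ℕ.+ V n < V (suc n) →
                       V (suc n) ℕ.+ V (suc n) < V (2+ n)
    ∣u∣-doubles-step n ∣u[n]∣+∣u[n]∣<x = ℕ.+-cancelʳ-< x (x ℕ.+ x) (V (2+ n)) (begin-strict
      x ℕ.+ x ℕ.+ x         ≡⟨ x+x+x≡3*x x ⟩
      3 ℕ.* x               ≤⟨ ℕ.*-monoˡ-≤ x 3≤∣a∣ ⟩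
      ∣ a ∣ ℕ.* x           ≤⟨ ∣a∣*∣u[1+n]∣≤∣u[2+n]∣+∣u[n]∣ n ⟩
      V (2+ n) ℕ.+ V n      <⟨ ℕ.+-monoʳ-< (V (2+ n)) ∣u[n]∣<x ⟩
      V (2+ n) ℕ.+ x        ∎)
      where
      open ℕ.≤-Reasoning
      x : ℕ
      x = V (suc n)
      ∣u[n]∣<x : V n < x
      ∣u[n]∣<x = ℕ.≤-<-trans (ℕ.m≤m+n (V n) (V n)) ∣u[n]∣+∣u[n]∣<x
      x+x+x≡3*x : ∀ x → x ℕ.+ x ℕ.+ x ≡ 3 ℕ.* x
      x+x+x≡3*x = ℕ-Solver.solve-∀

    ∣u∣-doubles : ∀ n → V n ℕ.+ V n < V (suc n)
    ∣u∣-doubles zero = s≤s z≤n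
    ∣u∣-doubles (suc zero) = subst (2 <_) (cong ∣_∣ (sym (u[2]≡a a))) 3≤∣a∣
      where
      u[2]≡a : ∀ a → a * 1ℤ + -1ℤ * 0ℤ ≡ a
      u[2]≡a = solve-∀
    ∣u∣-doubles (2+ n) = ∣u∣-doubles-step (suc n) (∣u∣-doubles (suc n))

    ∣u[n]∣≤∣u[1+n]∣ : ∀ n → V n ≤ V (suc n)
    ∣u[n]∣≤∣u[1+n]∣ n = ℕ.≤-trans (ℕ.m≤m+n (V n) (V n)) (ℕ.<⇒≤ (∣u∣-doubles n))

    ∣u[1+n]∣+2≤∣u[2+n]∣ : ∀ n → V (suc n) ℕ.+ 2 ≤ V (2+ n)
    ∣u[1+n]∣+2≤∣u[2+n]∣ n = begin
      x ℕ.+ 2               ≡⟨ ℕ.+-suc x 1 ⟩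
      suc (x ℕ.+ 1)         ≤⟨ s≤s (ℕ.+-monoʳ-≤ x (ℕ.≤-<-trans z≤n (∣u∣-doubles n))) ⟩
      suc (x ℕ.+ x)         ≤⟨ ∣u∣-doubles (suc n) ⟩
      V (2+ n)              ∎
      where
      open ℕ.≤-Reasoning
      x : ℕ
      x = V (suc n)

    composite-∣u[4+2k]∣ : ∀ k → Composite (V (2+ k ℕ.+ 2+ k))
    composite-∣u[4+2k]∣ k =
      subst Composite (sym factorisation) (composite-* 2≤∣u[2+k]∣ 2≤∣u[3+k]-u[1+k]∣)
      where
      factorisation : V (2+ k ℕ.+ 2+ k) ≡ V (2+ k) ℕ.* ∣ U (3 ℕ.+ k) - U (suc k) ∣
      factorisation = trans (cong ∣_∣ (u[2+2k]≡u[1+k]*[u[2+k]-u[k]] (suc k)))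
                            (ℤ.∣i*j∣≡∣i∣*∣j∣ (U (2+ k)) (U (3 ℕ.+ k) - U (suc k)))
      2≤∣u[2+k]∣ : 2 ≤ V (2+ k)
      2≤∣u[2+k]∣ = ℕ.≤-trans (ℕ.m≤n+m 2 (V (suc k))) (∣u[1+n]∣+2≤∣u[2+n]∣ k)
      2≤∣u[3+k]-u[1+k]∣ : 2 ≤ ∣ U (3 ℕ.+ k) - U (suc k) ∣
      2≤∣u[3+k]-u[1+k]∣ = ∣j∣+2≤∣i∣⇒2≤∣i-j∣ (U (3 ℕ.+ k)) (U (suc k))
        (ℕ.≤-trans (ℕ.+-monoˡ-≤ 2 (∣u[n]∣≤∣u[1+n]∣ (suc k))) (∣u[1+n]∣+2≤∣u[2+n]∣ (suc k)))

    composite-∣u[3+2k]∣ : ∀ k → Composite (V (suc (suc k ℕ.+ suc k)))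
    composite-∣u[3+2k]∣ k = subst Composite (sym factorisation)
      (composite-* (∣j∣+2≤∣i∣⇒2≤∣i+j∣ y x gap) (∣j∣+2≤∣i∣⇒2≤∣i-j∣ y x gap))
      where
      x y : ℤ
      x = U (suc k)
      y = U (2+ k)
      gap : ∣ x ∣ ℕ.+ 2 ≤ ∣ y ∣
      gap = ∣u[1+n]∣+2≤∣u[2+n]∣ k
      factorisation : V (suc (suc k ℕ.+ suc k)) ≡ ∣ y + x ∣ ℕ.* ∣ y - x ∣
      factorisation = trans (cong ∣_∣ (u[1+2k]≡[u[1+k]+u[k]]*[u[1+k]-u[k]] (suc k)))
                            (ℤ.∣i*j∣≡∣i∣*∣j∣ (y + x) (y - x))

theorem6p1 : (a : ℤ) → 3 ≤ ∣ a ∣ → (n : ℕ) → 3 ≤ n → Composite ∣ u a -[1+ 0 ] n ∣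
theorem6p1 a 3≤∣a∣ n 3≤n with even-or-odd n
... | 2+ k  , inj₁ refl = composite-∣u[4+2k]∣ a 3≤∣a∣ k
... | suc k , inj₂ refl = composite-∣u[3+2k]∣ a 3≤∣a∣ k
... | 0     , inj₁ refl = contradiction 3≤n λ ()
... | 1     , inj₁ refl = contradiction 3≤n λ { (s≤s (s≤s ())) }
... | 0     , inj₂ refl = contradiction 3≤n λ { (s≤s ()) }
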